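{- Let $(G,T,k)$ be a non-trivial instance of \textsc{Multiway Near-Separator} and let $S \subseteq V(G)\setminus T$ be a solution. Then there exist a terminal $t \in T$ and a solution $S^* \subseteq V(G)\setminus T$ with $|S^*| \le |S|$ for which one of the following holds: (1) there is an important $(\{t\},T\setminus\{t\})$-separator $S^*_t$ of size at most $k$ with $S^*_t \subseteq S^*$; or (2) there is an important $(\{t\},T\setminus\{t\})$-separator $S_t$ of size at most $k+1$ and a vertex $v \in S_t$ such that $S_t \setminus\{v\} \subseteq S^*$. Here important separators are taken with the vertices of $T$ undeletable, i.e. among separators contained in $V(G)\setminus T$.
   Context: All graphs are finite, simple and undirected. Given a graph $G$ and $T \subseteq V(G)$, a set $S \subseteq V(G)$ is a multiway near-separator (MWNS) of $(G,T)$ if $S \cap T = \emptyset$ and there is no pair of distinct terminals $t_i,t_j \in T$ such that $G-S$ contains two internally vertex-disjoint $t_i$-$t_j$ paths (an edge $t_it_j$ counts as two such paths). An instance $(G,T,k)$ of \textsc{Multiway Near-Separator} consists of a graph $G$, $T\subseteq V(G)$ and a positive integer $k$; a solution is a set $S \subseteq V(G)\setminus T$ with $|S|\le k$ that is an MWNS of $(G,T)$; the instance is non-trivial if $\emptyset$ is not a solution. For $X,Y\subseteq V(G)$, a set $S$ is an $(X,Y)$-separator if $G-S$ has no path from $X\setminus S$ to $Y\setminus S$. Given a set $V^\infty \subseteq V(G)$ of undeletable vertices, an $(X,Y)$-separator $S \subseteq V(G)\setminus V^\infty$ with $R$ the set of vertices reachable from $X\setminus S$ in $G-S$ is an important $(X,Y)$-separator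 if it is inclusion-wise minimal and there is no $(X,Y)$-separator $S' \subseteq V(G)\setminus V^\infty$ with $|S'|\le|S|$ whose reachable set $R'$ (vertices reachable from $X\setminus S'$ in $G-S'$) satisfies $R \subsetneq R'$. -}

module Defs where

open import Data.Nat using (ℕ; _≤_; suc)
open import Data.Fin using (Fin)
open import Data.Fin.Subset using (Subset; _∈_; _∉_; _⊆_; _∩_; _─_; _-_; ⁅_⁆; ∣_∣; Empty; ⊥)
open import Data.Bool using (Bool; true; false)
open import Data.List using (List; []; _∷_)
open import Data.List.Relation.Unary.Unique.Propositional using (Unique)
import Data.List.Membership.Propositional as LM
open import Data.Product using (Σ; ∃; ∃-syntax; _×_; _,_)
open import Data.Sum using (_⊎_)
open import Relation.Nullary using (¬_)
open import Relation.Binary.PropositionalEquality using (_≡_; _≢_)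

record Graph (n : ℕ) : Set where
  field
    E     : Fin n → Fin n → Bool
    sym   : ∀ u v → E u v ≡ E v u
    irrefl : ∀ v → E v v ≡ false
open Graph public

module _ {n : ℕ} (G : Graph n) (S : Subset n) where

  data WalkIn : Fin n → Fin n → List (Fin n) → Set where
    single : ∀ {v} → v ∉ S → WalkIn v v (v ∷ [])
    cons   : ∀ {u w v vs} → u ∉ S → E G u w ≡ true → WalkIn w v vs →
             WalkIn u v (u ∷ vs)

  PathIn : Fin n → Fin n → List (Fin n) → Set
  PathIn u v vs = WalkIn u v vs × Unique vs

  -- Two u-v paths are internally vertex-disjoint: they share only u and v.
  -- (Two copies of the single-edge path u v are internally disjoint, so an
  -- edge u v counts as two such paths.)
  TwoDisjointPaths : Fin n → Fin n → Set
  TwoDisjointPaths u v =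
    ∃[ P ] ∃[ Q ] (PathIn u v P × PathIn u v Q ×
      (∀ x → x LM.∈ P → x LM.∈ Q → (x ≡ u ⊎ x ≡ v)))

  Reach : Fin n → Fin n → Set
  Reach x y = ∃[ vs ] WalkIn x y vs

module _ {n : ℕ} (G : Graph n) where

  IsMWNS : Subset n → Subset n → Set
  IsMWNS T S = Empty (S ∩ T) ×
    (∀ ti tj → ti ∈ T → tj ∈ T → ti ≢ tj → ¬ TwoDisjointPaths G S ti tj)

  IsSolution : Subset n → ℕ → Subset n → Set
  IsSolution T k S = ∣ S ∣ ≤ k × IsMWNS T S

  NonTrivial : Subset n → ℕ → Set
  NonTrivial T k = ¬ IsSolution T k ⊥

  IsSep : Subset n → Subset n → Subset n → Set
  IsSep X Y S = ∀ x y → x ∈ X → y ∈ Y → ¬ Reach G S x y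

  Reachable : Subset n → Subset n → Fin n → Set
  Reachable X S v = ∃[ x ] (x ∈ X × Reach G S x v)

  IsImportant : Subset n → Subset n → Subset n → Subset n → Set
  IsImportant Vinf X Y S =
    Empty (S ∩ Vinf) × IsSep X Y S ×
    (∀ S' → S' ⊆ S → IsSep X Y S' → S ⊆ S') ×
    (∀ S' → Empty (S' ∩ Vinf) → IsSep X Y S' → ∣ S' ∣ ≤ ∣ S ∣ →
       ¬ ((∀ v → Reachable X S v → Reachable X S' v) ×
          (∃[ v ] (Reachable X S' v × ¬ Reachable X S v))))

{-# OPTIONS --safe #-}
-- In G - S no two terminals are joined by two internally disjoint paths, so by Menger's theorem
-- any two terminals still connected in G - S are separated by a single vertex. Walking along such
-- cut vertices, the set reachable from the current terminal shrinks strictly, and one ends with a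
-- terminal t and a set Z of at most one non-terminal such that S ∪ Z separates t from T - t.
-- The vertices of S ∪ Z adjacent to the component of t form a (t, T - t)-separator X with
-- |X| ≤ |S| + 1, dominated by an important separator I with |I| ≤ |X|. If I ⊆ S, keep S;
-- otherwise choose w ∈ I - S and put S* = (S - X) ∪ (I - w). Then |S*| ≤ |S|, and S* is still a
-- near-separator: in G - S* every path leaving the t-side of I passes through w, and paths that
-- never enter that side already exist in G - S.
module Submission where

open import Defs
open import Data.Bool using (true)
import Data.Bool as Bool
open import Data.Empty using (⊥-elim)
open import Data.Fin using (Fin; zero; suc; _≟_)
open import Data.Fin.Properties using (any?; all?)
open import Data.Fin.Subset
  using (Subset; _∈_; _∉_; _⊆_; _∩_; _∪_; _─_; _-_; ⁅_⁆; ∣_∣; Empty; ⊥; inside; outside)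
open import Data.Fin.Subset.Properties
  using (_∈?_; x∈p∧x∉q⇒x∈p─q; x∈p∪q⁻; x∈p∩q⁺; x∈p∩q⁻; x∈⁅x⁆; x∈⁅y⁆⇒x≡y; ∉⊥; ∈⊤; p⊆p∪q; q⊆p∪q;
         p─q⊆p; x∈p∧x≢y⇒x∈p-y; p⊂q⇒∣p∣<∣q∣; p⊆q⇒∣p∣≤∣q∣; x∈p⇒∣p-x∣<∣p∣; ∣⊥∣≡0; ∣⁅x⁆∣≡1;
         ∣p∣≤n; ∣p∣≡n⇒p≡⊤; anySubset?; nonempty?)
open import Data.List using (List; []; _∷_; _++_)
open import Data.List.Relation.Unary.All.Properties.Core using (¬Any⇒All¬)
open import Data.List.Relation.Unary.Any using (here; there)
open import Data.List.Relation.Unary.Unique.Propositional using (Unique; []; _∷_)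
open import Data.List.Relation.Unary.Unique.Propositional.Properties using (Unique[x∷xs]⇒x∉xs; ++⁺)
open import Data.List.Relation.Binary.Disjoint.Propositional using (Disjoint)
open import Data.List.Membership.Propositional using () renaming (_∈_ to _∈ₗ_; _∉_ to _∉ₗ_)
open import Data.List.Membership.Propositional.Properties using (∈-++⁺ʳ; ∈-++⁻)
import Data.List.Membership.DecPropositional as DecMembership
open import Data.Nat using (ℕ; zero; suc; _+_; _*_; _∸_; _≤_; _<_; z≤n; s≤s; _≤?_; _<?_) renaming (_≟_ to _≟ℕ_)
open import Data.Nat.Properties
  using (≤-refl; ≤-trans; ≤-pred; ≤-antisym; ≤-reflexive; n≤1+n; n<1+n; <-irrefl; <-≤-trans; ≮⇒≥; m≤n⇒m<n∨m≡n;
         +-comm; +-suc; +-identityʳ; +-monoˡ-≤; +-monoʳ-≤; +-monoʳ-<; *-monoˡ-≤; ∸-monoʳ-<; m≤m+n; m≤n+m;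
         module ≤-Reasoning)
open import Data.Nat.Induction using (<-wellFounded)
open import Data.Product using (∃-syntax; _×_; _,_; proj₁; proj₂)
open import Data.Sum using (_⊎_; inj₁; inj₂; [_,_]′)
open import Data.Vec using ([]; _∷_; tabulate; here; there)
open import Data.Vec.Properties using ([]=⇒lookup; lookup⇒[]=; lookup∘tabulate)
open import Function using (_∘_; id)
open import Induction.WellFounded using (Acc; acc)
open import Relation.Nullary using (¬_; Dec; yes; no; does; contradiction)
open import Relation.Nullary.Decidable using (_×-dec_; _⊎-dec_; ¬?; _→-dec_; map′; dec-true; decidable-stable)
open import Relation.Unary using (Decidable)
open import Relation.Binary.PropositionalEquality as ≡ using (_≡_; _≢_; refl; cong; subst)

private
  variable
    n : ℕ

∉-∪ : {x : Fin n} {p q : Subset n} → x ∉ p → x ∉ q → x ∉ p ∪ q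
∉-∪ {p = p} {q} x∉p x∉q x∈p∪q = [ x∉p , x∉q ]′ (x∈p∪q⁻ p q x∈p∪q)

∉-∪⁅⁆ : {x c : Fin n} {p : Subset n} → x ∉ p → x ≢ c → x ∉ p ∪ ⁅ c ⁆
∉-∪⁅⁆ {c = c} x∉p x≢c = ∉-∪ x∉p (x≢c ∘ x∈⁅y⁆⇒x≡y c)

∈-∪⁅⁆ : (p : Subset n) (c : Fin n) → c ∈ p ∪ ⁅ c ⁆
∈-∪⁅⁆ p c = q⊆p∪q p ⁅ c ⁆ (x∈⁅x⁆ c)

p⊆r∧q⊆r⇒p∪q⊆r : {p q r : Subset n} → p ⊆ r → q ⊆ r → p ∪ q ⊆ r
p⊆r∧q⊆r⇒p∪q⊆r {p = p} {q} p⊆r q⊆r x∈p∪q = [ p⊆r , q⊆r ]′ (x∈p∪q⁻ p q x∈p∪q)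

x∈p⇒p∪⁅x⁆⊆p : {x : Fin n} {p : Subset n} → x ∈ p → p ∪ ⁅ x ⁆ ⊆ p
x∈p⇒p∪⁅x⁆⊆p {x = x} x∈p = p⊆r∧q⊆r⇒p∪q⊆r id λ y∈⁅x⁆ → subst (_∈ _) (≡.sym (x∈⁅y⁆⇒x≡y x y∈⁅x⁆)) x∈p

Empty[⊥∩p] : {p : Subset n} → Empty (⊥ ∩ p)
Empty[⊥∩p] {p = p} (_ , x∈⊥∩p) = ∉⊥ (proj₁ (x∈p∩q⁻ ⊥ p x∈⊥∩p))

Empty-∩-⊆ : {p q r : Subset n} → p ⊆ q → Empty (q ∩ r) → Empty (p ∩ r)
Empty-∩-⊆ {p = p} {r = r} p⊆q q∩r (x , x∈p∩r) with x∈p∩q⁻ p r x∈p∩r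
... | x∈p , x∈r = q∩r (x , x∈p∩q⁺ (p⊆q x∈p , x∈r))

Empty-∪-∩ : {p q r : Subset n} → Empty (p ∩ r) → Empty (q ∩ r) → Empty ((p ∪ q) ∩ r)
Empty-∪-∩ {p = p} {q} {r} p∩r q∩r (x , x∈) with x∈p∩q⁻ (p ∪ q) r x∈
... | x∈p∪q , x∈r = [ (λ x∈p → p∩r (x , x∈p∩q⁺ (x∈p , x∈r))) , (λ x∈q → q∩r (x , x∈p∩q⁺ (x∈q , x∈r))) ]′
  (x∈p∪q⁻ p q x∈p∪q)

x∉p⇒∣p∣<∣p∪⁅x⁆∣ : {x : Fin n} {p : Subset n} → x ∉ p → ∣ p ∣ < ∣ p ∪ ⁅ x ⁆ ∣
x∉p⇒∣p∣<∣p∪⁅x⁆∣ {x = x} {p} x∉p = p⊂q⇒∣p∣<∣q∣ (p⊆p∪q ⁅ x ⁆ , x , ∈-∪⁅⁆ p x , x∉p)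

x∈p─q⁻ : {x : Fin n} (p q : Subset n) → x ∈ p ─ q → x ∈ p × x ∉ q
x∈p─q⁻ (inside ∷ p) (outside ∷ q) here = here , λ ()
x∈p─q⁻ {x = zero} (outside ∷ p) (inside ∷ q) ()
x∈p─q⁻ {x = zero} (outside ∷ p) (outside ∷ q) ()
x∈p─q⁻ {x = zero} (inside ∷ p) (inside ∷ q) ()
x∈p─q⁻ (_ ∷ p) (_ ∷ q) (there x∈p─q) with x∈p─q⁻ p q x∈p─q
... | x∈p , x∉q = there x∈p , λ { (there x∈q) → x∉q x∈q }

x∈p-y⁻ : {x y : Fin n} (p : Subset n) → x ∈ p - y → x ∈ p × x ≢ y
x∈p-y⁻ {y = y} p x∈p-y with x∈p─q⁻ p ⁅ y ⁆ x∈p-y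
... | x∈p , x∉⁅y⁆ = x∈p , λ { refl → x∉⁅y⁆ (x∈⁅x⁆ y) }

∣p∪q∣≤∣p∣+∣q∣ : (p q : Subset n) → ∣ p ∪ q ∣ ≤ ∣ p ∣ + ∣ q ∣
∣p∪q∣≤∣p∣+∣q∣ []           []           = z≤n
∣p∪q∣≤∣p∣+∣q∣ (inside ∷ p) (inside ∷ q) = s≤s (≤-trans (∣p∪q∣≤∣p∣+∣q∣ p q) (+-monoʳ-≤ ∣ p ∣ (n≤1+n ∣ q ∣)))
∣p∪q∣≤∣p∣+∣q∣ (inside ∷ p) (outside ∷ q) = s≤s (∣p∪q∣≤∣p∣+∣q∣ p q)
∣p∪q∣≤∣p∣+∣q∣ (outside ∷ p) (inside ∷ q) = ≤-trans (s≤s (∣p∪q∣≤∣p∣+∣q∣ p q)) (≤-reflexive (≡.sym (+-suc ∣ p ∣ ∣ q ∣)))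
∣p∪q∣≤∣p∣+∣q∣ (outside ∷ p) (outside ∷ q) = ∣p∪q∣≤∣p∣+∣q∣ p q

∣p─q∣+∣q∣≤∣p∪q∣ : (p q : Subset n) → ∣ p ─ q ∣ + ∣ q ∣ ≤ ∣ p ∪ q ∣
∣p─q∣+∣q∣≤∣p∪q∣ []           []           = z≤n
∣p─q∣+∣q∣≤∣p∪q∣ (inside ∷ p) (inside ∷ q) = ≤-trans (≤-reflexive (+-suc ∣ p ─ q ∣ ∣ q ∣)) (s≤s (∣p─q∣+∣q∣≤∣p∪q∣ p q))
∣p─q∣+∣q∣≤∣p∪q∣ (outside ∷ p) (inside ∷ q) = ≤-trans (≤-reflexive (+-suc ∣ p ─ q ∣ ∣ q ∣)) (s≤s (∣p─q∣+∣q∣≤∣p∪q∣ p q))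
∣p─q∣+∣q∣≤∣p∪q∣ (inside ∷ p) (outside ∷ q) = s≤s (∣p─q∣+∣q∣≤∣p∪q∣ p q)
∣p─q∣+∣q∣≤∣p∪q∣ (outside ∷ p) (outside ∷ q) = ∣p─q∣+∣q∣≤∣p∪q∣ p q

subset : {P : Fin n → Set} → Decidable P → Subset n
subset P? = tabulate (does ∘ P?)

module _ {P : Fin n → Set} (P? : Decidable P) where

  ∈-subset⁺ : ∀ {x} → P x → x ∈ subset P?
  ∈-subset⁺ {x} px = lookup⇒[]= x _ (≡.trans (lookup∘tabulate (does ∘ P?) x) (dec-true (P? x) px))

  ∈-subset⁻ : ∀ {x} → x ∈ subset P? → P x
  ∈-subset⁻ {x} x∈ with P? x | ≡.trans (≡.sym (lookup∘tabulate (does ∘ P?) x)) ([]=⇒lookup x∈)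
  ... | yes px | _ = px
  ... | no _   | ()

⊆-by-size : {p q : Subset n} → p ⊆ q → ∣ q ∣ ≤ ∣ p ∣ → q ⊆ p
⊆-by-size {p = p} {q} p⊆q ∣q∣≤∣p∣ {x} x∈q = decidable-stable (x ∈? p) λ x∉p →
  <-irrefl refl (<-≤-trans (p⊂q⇒∣p∣<∣q∣ (p⊆q , x , x∈q , x∉p)) ∣q∣≤∣p∣)

_∈ₗ?_ : (x : Fin n) (xs : List (Fin n)) → Dec (x ∈ₗ xs)
_∈ₗ?_ = DecMembership._∈?_ _≟_

∷-unique : {A : Set} {x : A} {xs : List A} → x ∉ₗ xs → Unique xs → Unique (x ∷ xs)
∷-unique {xs = xs} x∉xs u = ¬Any⇒All¬ xs x∉xs ∷ u

Unique-++⁻ʳ : {A : Set} (xs : List A) {ys : List A} → Unique (xs ++ ys) → Unique ys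
Unique-++⁻ʳ []       u       = u
Unique-++⁻ʳ (_ ∷ xs) (_ ∷ u) = Unique-++⁻ʳ xs u

Unique-++⇒Disjoint : {A : Set} (xs : List A) {ys : List A} → Unique (xs ++ ys) → Disjoint xs ys
Unique-++⇒Disjoint (_ ∷ xs) u       (here refl , z∈ys) = Unique[x∷xs]⇒x∉xs u (∈-++⁺ʳ xs z∈ys)
Unique-++⇒Disjoint (_ ∷ xs) (_ ∷ u)  (there z∈xs , z∈ys) = Unique-++⇒Disjoint xs u (z∈xs , z∈ys)

∣p─q∪r-x∣<∣p∪q∣ : {p q r : Subset n} {x : Fin n} → x ∈ r → ∣ r ∣ ≤ ∣ q ∣ → ∣ (p ─ q) ∪ (r - x) ∣ < ∣ p ∪ q ∣
∣p─q∪r-x∣<∣p∪q∣ {p = p} {q} {r} {x} x∈r ∣r∣≤∣q∣ = begin-strict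
  ∣ (p ─ q) ∪ (r - x) ∣ ≤⟨ ∣p∪q∣≤∣p∣+∣q∣ (p ─ q) (r - x) ⟩
  ∣ p ─ q ∣ + ∣ r - x ∣ <⟨ +-monoʳ-< ∣ p ─ q ∣ (x∈p⇒∣p-x∣<∣p∣ x∈r) ⟩
  ∣ p ─ q ∣ + ∣ r ∣     ≤⟨ +-monoʳ-≤ ∣ p ─ q ∣ ∣r∣≤∣q∣ ⟩
  ∣ p ─ q ∣ + ∣ q ∣     ≤⟨ ∣p─q∣+∣q∣≤∣p∪q∣ p q ⟩
  ∣ p ∪ q ∣             ∎
  where open ≤-Reasoning

lex-< : ∀ {a a′ b b′ N} → b′ ≤ N → a′ < a ⊎ (a′ ≡ a × b′ < b) → a′ * suc N + b′ < a * suc N + b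
lex-< {a} {a′} {b} {b′} {N} b′≤N (inj₁ a′<a) = begin-strict
  a′ * suc N + b′    ≤⟨ +-monoʳ-≤ (a′ * suc N) b′≤N ⟩
  a′ * suc N + N     <⟨ +-monoʳ-< (a′ * suc N) (n<1+n N) ⟩
  a′ * suc N + suc N ≡⟨ +-comm (a′ * suc N) (suc N) ⟩
  suc a′ * suc N     ≤⟨ *-monoˡ-≤ (suc N) a′<a ⟩
  a * suc N          ≤⟨ m≤m+n (a * suc N) b ⟩
  a * suc N + b      ∎
  where open ≤-Reasoning
lex-< {a} {N = N} _ (inj₂ (refl , b′<b)) = +-monoʳ-< (a * suc N) b′<b

descent : {A : Set} {P : A → Set} {Q : Set} (μ : A → ℕ) →
          (∀ {x} → P x → Q ⊎ ∃[ y ] (P y × μ y < μ x)) → ∀ {x} → P x → Q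
descent {A} {P} {Q} μ step = go (<-wellFounded _)
  where
  go : ∀ {x} → Acc _<_ (μ x) → P x → Q
  go (acc rs) px with step px
  ... | inj₁ q            = q
  ... | inj₂ (y , py , <) = go (rs <) py

module _ {n : ℕ} (G : Graph n) where

  private
    variable
      A B : Subset n
      u v w x y c c′ : Fin n
      vs : List (Fin n)

  edge-sym : E G x y ≡ true → E G y x ≡ true
  edge-sym {x} {y} = ≡.trans (sym G y x)

  walk-head∉ : WalkIn G A u v vs → u ∉ A
  walk-head∉ (single u∉A)   = u∉A
  walk-head∉ (cons u∉A _ _) = u∉A

  walk-last∉ : WalkIn G A u v vs → v ∉ A
  walk-last∉ (single v∉A) = v∉A
  walk-last∉ (cons _ _ p) = walk-last∉ p

  walk-∉ : WalkIn G A u v vs → x ∈ₗ vs → x ∉ A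
  walk-∉ (single v∉A)   (here refl) = v∉A
  walk-∉ (cons u∉A _ _) (here refl) = u∉A
  walk-∉ (cons _ _ p)   (there x∈)  = walk-∉ p x∈

  walk-head∈ : WalkIn G A u v vs → u ∈ₗ vs
  walk-head∈ (single _)   = here refl
  walk-head∈ (cons _ _ _) = here refl

  walk-last∈ : WalkIn G A u v vs → v ∈ₗ vs
  walk-last∈ (single _)   = here refl
  walk-last∈ (cons _ _ p) = there (walk-last∈ p)

  walk-head≡ : WalkIn G A u v vs → ∃[ ys ] vs ≡ u ∷ ys
  walk-head≡ (single _)   = _ , refl
  walk-head≡ (cons _ _ _) = _ , refl

  walk-antimono : WalkIn G A u v vs → (∀ {x} → x ∈ₗ vs → x ∉ B) → WalkIn G B u v vs
  walk-antimono (single _)   avoid = single (avoid (here refl))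
  walk-antimono (cons _ e p) avoid = cons (avoid (here refl)) e (walk-antimono p (avoid ∘ there))

  reach-antimono : A ⊆ B → Reach G B u v → Reach G A u v
  reach-antimono A⊆B (_ , p) = _ , walk-antimono p (λ x∈ → walk-∉ p x∈ ∘ A⊆B)

  reach-head∉ : Reach G A u v → u ∉ A
  reach-head∉ = walk-head∉ ∘ proj₂

  reach-last∉ : Reach G A u v → v ∉ A
  reach-last∉ = walk-last∉ ∘ proj₂

  walk-++ : ∀ {xs ys} → WalkIn G A u x xs → WalkIn G A x v (x ∷ ys) → WalkIn G A u v (xs ++ ys)
  walk-++ (single _)   q = q
  walk-++ (cons h e p) q = cons h e (walk-++ p q)

  reach-refl : u ∉ A → Reach G A u u
  reach-refl u∉A = _ , single u∉A

  reach-trans : Reach G A u x → Reach G A x v → Reach G A u v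
  reach-trans (_ , p) (_ , q) with walk-head≡ q
  ... | _ , refl = _ , walk-++ p q

  reach-snoc : Reach G A u x → E G x y ≡ true → y ∉ A → Reach G A u y
  reach-snoc u⇝x e y∉A = reach-trans u⇝x (_ , cons (reach-last∉ u⇝x) e (single y∉A))

  reach-sym : Reach G A u v → Reach G A v u
  reach-sym (_ , single v∉A)   = reach-refl v∉A
  reach-sym (_ , cons u∉A e p) = reach-snoc (reach-sym (_ , p)) (edge-sym e) u∉A

  walk-split : WalkIn G A u v vs → x ∈ₗ vs →
    ∃[ pre ] ∃[ suf ] (vs ≡ pre ++ x ∷ suf × WalkIn G A u x (pre ++ x ∷ []) × WalkIn G A x v (x ∷ suf))
  walk-split (single h)   (here refl) = [] , [] , refl , single h , single h
  walk-split (cons h e p) (here refl) = [] , _ , refl , single h , cons h e p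
  walk-split {u = u} (cons h e p) (there x∈) with walk-split p x∈
  ... | pre , suf , refl , p₁ , p₂ = u ∷ pre , suf , refl , cons h e p₁ , p₂

  walk⇒path : WalkIn G A u v vs → ∃[ ps ] (PathIn G A u v ps × (∀ {x} → x ∈ₗ ps → x ∈ₗ vs))
  walk⇒path (single h) = _ , (single h , ∷-unique (λ ()) []) , id
  walk⇒path {u = u} (cons h e p) with walk⇒path p
  ... | ps , (q , uniq) , ps⊆ with u ∈ₗ? ps
  ...   | no u∉ps = u ∷ ps , (cons h e q , ∷-unique u∉ps uniq) ,
                    λ { (here refl) → here refl ; (there x∈) → there (ps⊆ x∈) }
  ...   | yes u∈ps with walk-split q u∈ps
  ...     | pre , suf , refl , _ , q₂ =
              u ∷ suf , (q₂ , Unique-++⁻ʳ pre uniq) , there ∘ ps⊆ ∘ ∈-++⁺ʳ pre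

  reach-first-step : Reach G A u v → u ≢ v → ∃[ w ] (E G u w ≡ true × Reach G (A ∪ ⁅ u ⁆) w v)
  reach-first-step (_ , p) u≢v with walk⇒path p
  ... | _ , (single _ , _) , _ = contradiction refl u≢v
  ... | _ , (cons _ e q , uniq) , _ =
    _ , e , _ , walk-antimono q (λ x∈ → ∉-∪⁅⁆ (walk-∉ q x∈) (λ { refl → Unique[x∷xs]⇒x∉xs uniq x∈ }))

  reach-cons : u ∉ A → E G u w ≡ true → Reach G A w v → Reach G A u v
  reach-cons u∉A e (_ , p) = _ , cons u∉A e p

  reach? : (A : Subset n) → ∀ u v → Dec (Reach G A u v)
  reach? A = bounded n A (m≤n+m n ∣ A ∣)
    where
    bounded : ∀ m (A : Subset n) → n ≤ ∣ A ∣ + m → ∀ u v → Dec (Reach G A u v)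
    bounded zero A n≤∣A∣ u v = no λ u⇝v → reach-head∉ u⇝v u∈A
      where
      u∈A : u ∈ A
      u∈A = subst (u ∈_) (≡.sym (∣p∣≡n⇒p≡⊤ (≤-antisym (∣p∣≤n A) (subst (n ≤_) (+-identityʳ _) n≤∣A∣)))) ∈⊤
    bounded (suc m) A n≤ u v with u ∈? A | u ≟ v
    ... | yes u∈A | _        = no λ u⇝v → reach-head∉ u⇝v u∈A
    ... | no u∉A  | yes refl = yes (reach-refl u∉A)
    ... | no u∉A  | no u≢v   =
      map′ (λ (_ , e , w⇝v) → reach-cons u∉A e (reach-antimono (p⊆p∪q ⁅ u ⁆) w⇝v))
           (λ u⇝v → reach-first-step u⇝v u≢v)
           (any? λ w → (E G u w Bool.≟ true) ×-dec bounded m (A ∪ ⁅ u ⁆) n≤′ w v)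
      where
      n≤′ : n ≤ ∣ A ∪ ⁅ u ⁆ ∣ + m
      n≤′ = ≤-trans n≤ (≤-trans (≤-reflexive (+-suc ∣ A ∣ m)) (+-monoˡ-≤ m (x∉p⇒∣p∣<∣p∪⁅x⁆∣ u∉A)))

  reach-avoids-or-enters : Reach G A u v → u ≢ c →
    Reach G (A ∪ ⁅ c ⁆) u v ⊎ ∃[ y ] (Reach G (A ∪ ⁅ c ⁆) u y × E G y c ≡ true)
  reach-avoids-or-enters {A = A} {c = c} (_ , p) = go p
    where
    go : ∀ {u v vs} → WalkIn G A u v vs → u ≢ c →
      Reach G (A ∪ ⁅ c ⁆) u v ⊎ ∃[ y ] (Reach G (A ∪ ⁅ c ⁆) u y × E G y c ≡ true)
    go (single u∉A) u≢c = inj₁ (reach-refl (∉-∪⁅⁆ u∉A u≢c))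
    go (cons {w = w} u∉A e p) u≢c with w ≟ c
    ... | yes refl = inj₂ (_ , reach-refl (∉-∪⁅⁆ u∉A u≢c) , e)
    ... | no w≢c with go p w≢c
    ...   | inj₁ w⇝v            = inj₁ (reach-cons (∉-∪⁅⁆ u∉A u≢c) e w⇝v)
    ...   | inj₂ (y , w⇝y , e′) = inj₂ (y , reach-cons (∉-∪⁅⁆ u∉A u≢c) e w⇝y , e′)

  reach-enters : Reach G A u c → u ≢ c → ∃[ y ] (Reach G (A ∪ ⁅ c ⁆) u y × E G y c ≡ true)
  reach-enters {A = A} {c = c} u⇝c u≢c with reach-avoids-or-enters u⇝c u≢c
  ... | inj₁ u⇝c′ = ⊥-elim (reach-last∉ u⇝c′ (∈-∪⁅⁆ A c))
  ... | inj₂ entry = entry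

  reach-without : c ∉ A → ¬ Reach G A u c → Reach G A u v → Reach G (A ∪ ⁅ c ⁆) u v
  reach-without {c = c} {u = u} c∉A ¬u⇝c u⇝v with u ≟ c
  ... | yes refl = contradiction (reach-refl (reach-head∉ u⇝v)) ¬u⇝c
  ... | no u≢c with reach-avoids-or-enters u⇝v u≢c
  ...   | inj₁ u⇝v′          = u⇝v′
  ...   | inj₂ (_ , u⇝y , e) = contradiction (reach-snoc (reach-antimono (p⊆p∪q ⁅ c ⁆) u⇝y) e c∉A) ¬u⇝c

  reach-through : c ∉ A → Reach G A u v → ¬ Reach G (A ∪ ⁅ c ⁆) u v → Reach G A u c
  reach-through {c = c} {A = A} {u = u} c∉A u⇝v ¬u⇝v =
    decidable-stable (reach? A u c) λ ¬u⇝c → ¬u⇝v (reach-without c∉A ¬u⇝c u⇝v)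

  reach-exchange : c ∉ A ∪ ⁅ c′ ⁆ → ¬ Reach G (A ∪ ⁅ c′ ⁆) u c →
    Reach G (A ∪ ⁅ c′ ⁆) u v → Reach G (A ∪ ⁅ c ⁆) u v
  reach-exchange c∉ ¬u⇝c =
    reach-antimono (p⊆r∧q⊆r⇒p∪q⊆r (p⊆p∪q _ ∘ p⊆p∪q _) (q⊆p∪q _ _)) ∘ reach-without c∉ ¬u⇝c

  reachSet : Subset n → Fin n → Subset n
  reachSet A u = subset (reach? A u)

  ∈-reachSet⁺ : Reach G A u v → v ∈ reachSet A u
  ∈-reachSet⁺ {A = A} {u = u} = ∈-subset⁺ (reach? A u)

  ∈-reachSet⁻ : v ∈ reachSet A u → Reach G A u v
  ∈-reachSet⁻ {A = A} {u = u} = ∈-subset⁻ (reach? A u)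

  ∣reachSet∣-mono : (∀ {v} → Reach G A u v → Reach G B w v) → ∣ reachSet A u ∣ ≤ ∣ reachSet B w ∣
  ∣reachSet∣-mono inc = p⊆q⇒∣p∣≤∣q∣ (∈-reachSet⁺ ∘ inc ∘ ∈-reachSet⁻)

  ∣reachSet∣-mono-< : (∀ {v} → Reach G A u v → Reach G B w v) →
    Reach G B w x → ¬ Reach G A u x → ∣ reachSet A u ∣ < ∣ reachSet B w ∣
  ∣reachSet∣-mono-< inc w⇝x ¬u⇝x =
    p⊂q⇒∣p∣<∣q∣ (∈-reachSet⁺ ∘ inc ∘ ∈-reachSet⁻ , _ , ∈-reachSet⁺ w⇝x , ¬u⇝x ∘ ∈-reachSet⁻)

  walk-first-hit : {D : Fin n → Set} → Decidable D → WalkIn G A u v vs → D v →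
    ∃[ x ] ∃[ rs ] (WalkIn G A u x rs × D x × (∀ {z} → z ∈ₗ rs → D z → z ≡ x))
  walk-first-hit D? (single h) Dv = _ , _ , single h , Dv , λ { (here refl) _ → refl }
  walk-first-hit {u = u} D? (cons h e p) Dv with D? u
  ... | yes Du = u , u ∷ [] , single h , Du , λ { (here refl) _ → refl }
  ... | no ¬Du with walk-first-hit D? p Dv
  ...   | x , rs , q , Dx , first = x , u ∷ rs , cons h e q , Dx ,
          λ { (here refl) Dz → contradiction Dz ¬Du ; (there z∈) Dz → first z∈ Dz }

  walk-head∈prefix : ∀ pre {suf} → WalkIn G A u v (pre ++ x ∷ suf) → u ≢ x → u ∈ₗ pre
  walk-head∈prefix []      p u≢x with walk-head≡ p
  ... | _ , refl = contradiction refl u≢x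
  walk-head∈prefix (_ ∷ _) p _   with walk-head≡ p
  ... | _ , refl = here refl

  edge⇒two-paths : u ∉ A → w ∉ A → u ≢ w → E G u w ≡ true → TwoDisjointPaths G A u w
  edge⇒two-paths {u = u} {w = w} u∉A w∉A u≢w e =
    _ , _ , uw , uw , λ { _ (here refl) _ → inj₁ refl ; _ (there (here refl)) _ → inj₂ refl }
    where
    uw : PathIn G _ u w (u ∷ w ∷ [])
    uw = cons u∉A e (single w∉A) , ∷-unique (λ { (here refl) → u≢w refl }) (∷-unique (λ ()) [])

  -- The two u–w paths are R followed by the part of P after x, and u u′ followed by Q.
  reroute : ∀ {A u u′ w x P Q R} → u ∉ A → E G u u′ ≡ true → u ≢ w →
    PathIn G A u′ w P → PathIn G A u′ w Q → (∀ z → z ∈ₗ P → z ∈ₗ Q → z ≡ u′ ⊎ z ≡ w) →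
    PathIn G (A ∪ ⁅ u′ ⁆) u x R → x ∈ₗ P →
    (∀ {z} → z ∈ₗ R → z ∈ₗ P → z ≡ x) → (∀ {z} → z ∈ₗ R → z ∈ₗ Q → z ≡ x) →
    TwoDisjointPaths G A u w
  reroute {A} {u} {u′} {w} {x} {P} {Q} {R} u∉A e u≢w (pP , uP) (pQ , uQ) P∩Q (pR , uR) x∈P R∩P R∩Q
    with walk-split pP x∈P
  ... | pre , suf , refl , _ , pSuf =
    R ++ suf , u ∷ Q , (walk-++ pR′ pSuf , uniqR++suf) , (cons u∉A e pQ , ∷-unique u∉Q uQ) , disjoint
    where
    pR′ : WalkIn G A u x R
    pR′ = walk-antimono pR λ z∈ → walk-∉ pR z∈ ∘ p⊆p∪q ⁅ u′ ⁆
    x≢u′ : x ≢ u′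
    x≢u′ refl = walk-last∉ pR (∈-∪⁅⁆ A u′)
    x∉suf : x ∉ₗ suf
    x∉suf = Unique[x∷xs]⇒x∉xs (Unique-++⁻ʳ pre uP)
    suf⊆P : ∀ {z} → z ∈ₗ suf → z ∈ₗ pre ++ x ∷ suf
    suf⊆P = ∈-++⁺ʳ pre ∘ there
    u′∉suf : u′ ∉ₗ suf
    u′∉suf z∈ = Unique-++⇒Disjoint pre uP (walk-head∈prefix pre pP (x≢u′ ∘ ≡.sym) , there z∈)
    x∈Q⇒x≡w : x ∈ₗ Q → x ≡ w
    x∈Q⇒x≡w x∈Q = [ (λ x≡u′ → contradiction x≡u′ x≢u′) , id ]′ (P∩Q x x∈P x∈Q)
    u∉Q : u ∉ₗ Q
    u∉Q u∈Q with R∩Q (walk-head∈ pR) u∈Q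
    ... | refl = u≢w (x∈Q⇒x≡w u∈Q)
    uniqR++suf : Unique (R ++ suf)
    uniqR++suf = ++⁺ uR (Unique-++⁻ʳ (x ∷ []) (Unique-++⁻ʳ pre uP))
      λ (z∈R , z∈suf) → x∉suf (subst (_∈ₗ suf) (R∩P z∈R (suf⊆P z∈suf)) z∈suf)
    disjoint : ∀ z → z ∈ₗ R ++ suf → z ∈ₗ u ∷ Q → z ≡ u ⊎ z ≡ w
    disjoint z _ (here refl) = inj₁ refl
    disjoint z z∈ (there z∈Q) with ∈-++⁻ R z∈
    ... | inj₁ z∈R with R∩Q z∈R z∈Q
    ...   | refl = inj₂ (x∈Q⇒x≡w z∈Q)
    disjoint z z∈ (there z∈Q) | inj₂ z∈suf =
      [ (λ { refl → contradiction z∈suf u′∉suf }) , inj₂ ]′ (P∩Q z (suf⊆P z∈suf) z∈Q)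

  path⇒two-paths : WalkIn G A u w vs → Unique vs → u ≢ w →
    (∀ c → c ≢ u → c ≢ w → Reach G (A ∪ ⁅ c ⁆) u w) → TwoDisjointPaths G A u w
  path⇒two-paths (single _) _ u≢w _ = contradiction refl u≢w
  path⇒two-paths {A} {u} {w} (cons {w = u′} u∉A e p) uniq@(_ ∷ uniq′) u≢w no-cut with u′ ≟ w
  ... | yes refl = edge⇒two-paths u∉A (walk-last∉ p) u≢w e
  ... | no u′≢w  = combine (path⇒two-paths p uniq′ u′≢w no-cut′) (no-cut u′ u′≢u u′≢w)
    where
    u∉p : ∀ {z} → z ∈ₗ _ → z ≢ u
    u∉p z∈ refl = Unique[x∷xs]⇒x∉xs uniq z∈
    u′≢u : u′ ≢ u
    u′≢u = u∉p (walk-head∈ p)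
    no-cut′ : ∀ c → c ≢ u′ → c ≢ w → Reach G (A ∪ ⁅ c ⁆) u′ w
    no-cut′ c c≢u′ c≢w with c ≟ u
    ... | yes refl = _ , walk-antimono p λ z∈ → ∉-∪⁅⁆ (walk-∉ p z∈) (u∉p z∈)
    ... | no c≢u   = reach-cons (∉-∪⁅⁆ (walk-head∉ p) (c≢u′ ∘ ≡.sym)) (edge-sym e) (no-cut c c≢u c≢w)
    -- Follow a u–w path avoiding u′ up to its first vertex on P or Q, then reroute.
    combine : TwoDisjointPaths G A u′ w → Reach G (A ∪ ⁅ u′ ⁆) u w → TwoDisjointPaths G A u w
    combine (P , Q , pathP , pathQ , P∩Q) (_ , r)
      with walk-first-hit (λ z → (z ∈ₗ? P) ⊎-dec (z ∈ₗ? Q)) r (inj₁ (walk-last∈ (proj₁ pathP)))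
    ... | x , _ , r′ , x∈P∪Q , first with walk⇒path r′
    ...   | R , pathR , R⊆ with x∈P∪Q
    ...     | inj₁ x∈P = reroute u∉A e u≢w pathP pathQ P∩Q pathR x∈P
                           (λ z∈ z∈P → first (R⊆ z∈) (inj₁ z∈P)) (λ z∈ z∈Q → first (R⊆ z∈) (inj₂ z∈Q))
    ...     | inj₂ x∈Q = reroute u∉A e u≢w pathQ pathP (λ z z∈Q z∈P → P∩Q z z∈P z∈Q) pathR x∈Q
                           (λ z∈ z∈Q → first (R⊆ z∈) (inj₂ z∈Q)) (λ z∈ z∈P → first (R⊆ z∈) (inj₁ z∈P))

  menger₂ : u ≢ w → Reach G A u w → (∀ c → c ≢ u → c ≢ w → Reach G (A ∪ ⁅ c ⁆) u w) →
    TwoDisjointPaths G A u w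
  menger₂ u≢w (_ , p) no-cut with walk⇒path p
  ... | _ , (q , uniq) , _ = path⇒two-paths q uniq u≢w no-cut

  cut-vertex : u ≢ w → Reach G A u w → ¬ TwoDisjointPaths G A u w →
    ∃[ c ] (c ≢ u × c ≢ w × ¬ Reach G (A ∪ ⁅ c ⁆) u w)
  cut-vertex {u} {w} {A} u≢w u⇝w ¬two
    with any? (λ c → ¬? (c ≟ u) ×-dec ¬? (c ≟ w) ×-dec ¬? (reach? (A ∪ ⁅ c ⁆) u w))
  ... | yes cut = cut
  ... | no ¬cut = contradiction (menger₂ u≢w u⇝w no-cut) ¬two
    where
    no-cut : ∀ c → c ≢ u → c ≢ w → Reach G (A ∪ ⁅ c ⁆) u w
    no-cut c c≢u c≢w = decidable-stable (reach? _ u w) λ ¬r → ¬cut (c , c≢u , c≢w , ¬r)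

Isolated : {n : ℕ} → Graph n → Subset n → Fin n → Subset n → Set
Isolated G T t Y = ∀ y → y ∈ T → y ≢ t → ¬ Reach G Y t y

module Isolation {n : ℕ} (G : Graph n) (T S : Subset n)
  (noTwo : ∀ ti tj → ti ∈ T → tj ∈ T → ti ≢ tj → ¬ TwoDisjointPaths G S ti tj) where

  IsolatedTerminal : Set
  IsolatedTerminal = ∃[ t ] ∃[ Z ] (t ∈ T × ∣ Z ∣ ≤ 1 × Empty (Z ∩ T) × Isolated G T t (S ∪ Z))

  other-terminal? : ∀ t Y → Dec (∃[ y ] (y ∈ T × y ≢ t × Reach G Y t y))
  other-terminal? t Y = any? λ y → (y ∈? T) ×-dec ¬? (y ≟ t) ×-dec reach? G Y t y

  isolated-by-S : ∀ {t} → t ∈ T → Isolated G T t S → IsolatedTerminal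
  isolated-by-S {t} t∈T isolated = t , ⊥ , t∈T , ∣⊥∣≤1 , Empty[⊥∩p] ,
    λ y y∈T y≢t → isolated y y∈T y≢t ∘ reach-antimono G (p⊆p∪q ⊥)
    where
    ∣⊥∣≤1 : ∣ ⊥ {n} ∣ ≤ 1
    ∣⊥∣≤1 = subst (_≤ 1) (≡.sym (∣⊥∣≡0 n)) z≤n

  -- The state (t , c) represents the component of t in G - (S ∪ ⁅ c ⁆).
  State : Fin n × Fin n → Set
  State (t , c) = t ∈ T × c ∉ S × c ≢ t

  μ : Fin n × Fin n → ℕ
  μ (t , c) = ∣ reachSet G (S ∪ ⁅ c ⁆) t ∣

  Smaller : Fin n × Fin n → Set
  Smaller s = ∃[ s′ ] (State s′ × μ s′ < μ s)

  terminal-cut : ∀ {t t′} → t ∈ T → t′ ∈ T → t ≢ t′ → Reach G S t t′ →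
    ∃[ c ] (State (t , c) × c ≢ t′ × ¬ Reach G (S ∪ ⁅ c ⁆) t t′)
  terminal-cut t∈T t′∈T t≢t′ t⇝t′ with cut-vertex G t≢t′ t⇝t′ (noTwo _ _ t∈T t′∈T t≢t′)
  ... | c , c≢t , c≢t′ , ¬t⇝t′ = c , (t∈T , c∉S , c≢t) , c≢t′ , ¬t⇝t′
    where
    c∉S : c ∉ S
    c∉S c∈S = ¬t⇝t′ (reach-antimono G (x∈p⇒p∪⁅x⁆⊆p c∈S) t⇝t′)

  past-other-terminal : ∀ {t c t′} → State (t , c) → t′ ∈ T → t′ ≢ t → Reach G (S ∪ ⁅ c ⁆) t t′ →
    Smaller (t , c)
  past-other-terminal {t} {c} {t′} (t∈T , c∉S , c≢t) t′∈T t′≢t t⇝t′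
    with terminal-cut t∈T t′∈T (t′≢t ∘ ≡.sym) (reach-antimono G (p⊆p∪q _) t⇝t′)
  ... | c′ , st′@(_ , c′∉S , _) , c′≢t′ , ¬t⇝t′ = shrink (reach? G (S ∪ ⁅ c′ ⁆) t c)
    where
    c′≢c : c′ ≢ c
    c′≢c refl = ¬t⇝t′ t⇝t′
    c∉S∪c′ : c ∉ S ∪ ⁅ c′ ⁆
    c∉S∪c′ = ∉-∪⁅⁆ c∉S (c′≢c ∘ ≡.sym)
    t⇝c′ : Reach G (S ∪ ⁅ c ⁆) t c′
    t⇝c′ = reach-through G (∉-∪⁅⁆ c′∉S c′≢c) t⇝t′
      (¬t⇝t′ ∘ reach-antimono G (p⊆r∧q⊆r⇒p∪q⊆r (p⊆p∪q _ ∘ p⊆p∪q _) (q⊆p∪q _ _)))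
    c′-cut : ∀ {u} → ¬ Reach G (S ∪ ⁅ c′ ⁆) u c′
    c′-cut u⇝c′ = reach-last∉ G u⇝c′ (∈-∪⁅⁆ S c′)
    -- Keep t if c′ cuts c off from t; otherwise c lies on the side of t and we move to t′.
    shrink : Dec (Reach G (S ∪ ⁅ c′ ⁆) t c) → Smaller (t , c)
    shrink (no ¬t⇝c) = (t , c′) , st′ , ∣reachSet∣-mono-< G (reach-exchange G c∉S∪c′ ¬t⇝c) t⇝c′ c′-cut
    shrink (yes t⇝c) = (t′ , c′) , (t′∈T , c′∉S , c′≢t′) , ∣reachSet∣-mono-< G inc t⇝c′ c′-cut
      where
      inc : ∀ {v} → Reach G (S ∪ ⁅ c′ ⁆) t′ v → Reach G (S ∪ ⁅ c ⁆) t v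
      inc = reach-trans G t⇝t′ ∘ reach-exchange G c∉S∪c′ (¬t⇝t′ ∘ reach-trans G t⇝c ∘ reach-sym G)

  past-terminal-cut : ∀ {t c} → State (t , c) → c ∈ T → Reach G S t c → Smaller (t , c)
  past-terminal-cut {t} {c} (t∈T , c∉S , c≢t) c∈T t⇝c
    with terminal-cut t∈T c∈T (c≢t ∘ ≡.sym) t⇝c | reach-enters G t⇝c (c≢t ∘ ≡.sym)
  ... | c′ , st′ , c′≢c , ¬t⇝c | y , t⇝y , y~c =
    (t , c′) , st′ , ∣reachSet∣-mono-< G (reach-exchange G c∉S∪c′ ¬t⇝c) t⇝y
                       λ t⇝y′ → ¬t⇝c (reach-snoc G t⇝y′ y~c c∉S∪c′)
    where
    c∉S∪c′ : c ∉ S ∪ ⁅ c′ ⁆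
    c∉S∪c′ = ∉-∪⁅⁆ c∉S (c′≢c ∘ ≡.sym)

  step : ∀ {s} → State s → IsolatedTerminal ⊎ Smaller s
  step {t , c} st@(t∈T , c∉S , c≢t) with other-terminal? t (S ∪ ⁅ c ⁆)
  ... | yes (t′ , t′∈T , t′≢t , t⇝t′) = inj₂ (past-other-terminal st t′∈T t′≢t t⇝t′)
  ... | no none with c ∈? T
  ...   | no c∉T = inj₁ (t , ⁅ c ⁆ , t∈T , ≤-reflexive (∣⁅x⁆∣≡1 c) , ⁅c⁆∩T-empty ,
                          λ y y∈T y≢t t⇝y → none (y , y∈T , y≢t , t⇝y))
    where
    ⁅c⁆∩T-empty : Empty (⁅ c ⁆ ∩ T)
    ⁅c⁆∩T-empty (x , x∈) with x∈p∩q⁻ ⁅ c ⁆ T x∈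
    ... | x∈⁅c⁆ , x∈T = c∉T (subst (_∈ T) (x∈⁅y⁆⇒x≡y c x∈⁅c⁆) x∈T)
  ...   | yes c∈T with reach? G S t c
  ...     | yes t⇝c  = inj₂ (past-terminal-cut st c∈T t⇝c)
  ...     | no ¬t⇝c = inj₁ (isolated-by-S t∈T λ y y∈T y≢t t⇝y →
                                 none (y , y∈T , y≢t , reach-without G c∉S ¬t⇝c t⇝y))

  isolated-terminal : ∀ {t₀} → t₀ ∈ T → IsolatedTerminal
  isolated-terminal {t₀} t₀∈T with other-terminal? t₀ S
  ... | no none = isolated-by-S t₀∈T λ y y∈T y≢t₀ t₀⇝y → none (y , y∈T , y≢t₀ , t₀⇝y)
  ... | yes (t′ , t′∈T , t′≢t₀ , t₀⇝t′) with terminal-cut t₀∈T t′∈T (t′≢t₀ ∘ ≡.sym) t₀⇝t′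
  ...   | _ , st , _ = descent μ step st

module ImportantSeparator {n : ℕ} (G : Graph n) (V∞ Y : Subset n) (t : Fin n) where

  Sep : Subset n → Set
  Sep = IsSep G ⁅ t ⁆ Y

  sep? : ∀ X → Dec (Sep X)
  sep? X = all? λ x → all? λ y → (x ∈? ⁅ t ⁆) →-dec ((y ∈? Y) →-dec ¬? (reach? G X x y))

  reachable⇒reach : ∀ {X v} → Reachable G ⁅ t ⁆ X v → Reach G X t v
  reachable⇒reach {X} {v} (x , x∈⁅t⁆ , x⇝v) = subst (λ x → Reach G X x v) (x∈⁅y⁆⇒x≡y t x∈⁅t⁆) x⇝v

  reach⇒reachable : ∀ {X v} → Reach G X t v → Reachable G ⁅ t ⁆ X v
  reach⇒reachable t⇝v = t , x∈⁅x⁆ t , t⇝v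

  R : Subset n → Subset n
  R X = reachSet G X t

  module _ (X₀ : Subset n) where

    Candidate : Subset n → Set
    Candidate X = Empty (X ∩ V∞) × Sep X × ∣ X ∣ ≤ ∣ X₀ ∣ × (∀ {v} → Reach G X₀ t v → Reach G X t v)

    candidate? : ∀ X → Dec (Candidate X)
    candidate? X = ¬? (nonempty? (X ∩ V∞)) ×-dec sep? X ×-dec (∣ X ∣ ≤? ∣ X₀ ∣) ×-dec
      map′ (λ dom {v} → dom v) (λ dom v → dom) (all? λ v → reach? G X₀ t v →-dec reach? G X t v)

    Better : Subset n → Subset n → Set
    Better X′ X = Candidate X′ × (∣ R X ∣ < ∣ R X′ ∣ ⊎ (∣ R X ∣ ≡ ∣ R X′ ∣ × ∣ X′ ∣ < ∣ X ∣))

    better? : ∀ X X′ → Dec (Better X′ X)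
    better? X X′ = candidate? X′ ×-dec ((∣ R X ∣ <? ∣ R X′ ∣) ⊎-dec
      ((∣ R X ∣ ≟ℕ ∣ R X′ ∣) ×-dec (∣ X′ ∣ <? ∣ X ∣)))

    -- Orders separators lexicographically: larger reach set first, then smaller size.
    μ : Subset n → ℕ
    μ X = (n ∸ ∣ R X ∣) * suc n + ∣ X ∣

    μ-decreases : ∀ {X X′} → Better X′ X → μ X′ < μ X
    μ-decreases {X} {X′} (_ , improvement) = lex-< (∣p∣≤n X′) (lexicographic improvement)
      where
      lexicographic : ∣ R X ∣ < ∣ R X′ ∣ ⊎ (∣ R X ∣ ≡ ∣ R X′ ∣ × ∣ X′ ∣ < ∣ X ∣) →
        n ∸ ∣ R X′ ∣ < n ∸ ∣ R X ∣ ⊎ (n ∸ ∣ R X′ ∣ ≡ n ∸ ∣ R X ∣ × ∣ X′ ∣ < ∣ X ∣)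
      lexicographic (inj₁ <R)         = inj₁ (∸-monoʳ-< <R (∣p∣≤n (R X′)))
      lexicographic (inj₂ (≡R , <X))  = inj₂ (cong (n ∸_) (≡.sym ≡R) , <X)

    Dominated : Set
    Dominated = ∃[ I ] (IsImportant G V∞ ⁅ t ⁆ Y I × ∣ I ∣ ≤ ∣ X₀ ∣ ×
                        (∀ {v} → Reach G X₀ t v → Reach G I t v))

    optimal⇒important : ∀ {I} → Candidate I → ¬ (∃[ X ] Better X I) → Dominated
    optimal⇒important {I} (I∩V∞ , sepI , ∣I∣≤ , domI) optimal =
      I , (I∩V∞ , sepI , minimal , maximal) , ∣I∣≤ , domI
      where
      minimal : ∀ X → X ⊆ I → Sep X → I ⊆ X
      minimal X X⊆I sepX = ⊆-by-size X⊆I ∣I∣≤∣X∣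
        where
        grows : ∀ {v} → Reach G I t v → Reach G X t v
        grows = reach-antimono G X⊆I
        candidate : Candidate X
        candidate = Empty-∩-⊆ X⊆I I∩V∞ , sepX , ≤-trans (p⊆q⇒∣p∣≤∣q∣ X⊆I) ∣I∣≤ , grows ∘ domI
        ∣I∣≤∣X∣ : ∣ I ∣ ≤ ∣ X ∣
        ∣I∣≤∣X∣ with m≤n⇒m<n∨m≡n (∣reachSet∣-mono G grows)
        ... | inj₁ <R = ⊥-elim (optimal (X , candidate , inj₁ <R))
        ... | inj₂ ≡R with ∣ X ∣ <? ∣ I ∣
        ...   | yes <X = ⊥-elim (optimal (X , candidate , inj₂ (≡R , <X)))
        ...   | no ≮X  = ≮⇒≥ ≮X
      maximal : ∀ X → Empty (X ∩ V∞) → Sep X → ∣ X ∣ ≤ ∣ I ∣ →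
        ¬ ((∀ v → Reachable G ⁅ t ⁆ I v → Reachable G ⁅ t ⁆ X v) ×
           (∃[ v ] (Reachable G ⁅ t ⁆ X v × ¬ Reachable G ⁅ t ⁆ I v)))
      maximal X X∩V∞ sepX ∣X∣≤ (grows , v , X⇝v , ¬I⇝v) =
        optimal (X , (X∩V∞ , sepX , ≤-trans ∣X∣≤ ∣I∣≤ , grows′ ∘ domI) ,
                 inj₁ (∣reachSet∣-mono-< G grows′ (reachable⇒reach X⇝v) (¬I⇝v ∘ reach⇒reachable)))
        where
        grows′ : ∀ {v} → Reach G I t v → Reach G X t v
        grows′ = reachable⇒reach ∘ grows _ ∘ reach⇒reachable

    important-dominating : Empty (X₀ ∩ V∞) → Sep X₀ → Dominated
    important-dominating X₀∩V∞ sepX₀ = descent μ step (X₀∩V∞ , sepX₀ , ≤-refl , id)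
      where
      step : ∀ {X} → Candidate X → Dominated ⊎ ∃[ X′ ] (Candidate X′ × μ X′ < μ X)
      step {X} cand with anySubset? (better? X)
      ... | yes (X′ , better) = inj₂ (X′ , proj₁ better , μ-decreases better)
      ... | no optimal        = inj₁ (optimal⇒important cand optimal)

module Boundary {n : ℕ} (G : Graph n) (Y : Subset n) (t : Fin n) where

  Adjacent : Fin n → Set
  Adjacent x = ∃[ r ] (Reach G Y t r × E G r x ≡ true)

  on-boundary? : Decidable λ x → x ∈ Y × Adjacent x
  on-boundary? x = (x ∈? Y) ×-dec any? λ r → reach? G Y t r ×-dec (E G r x Bool.≟ true)

  boundary : Subset n
  boundary = subset on-boundary?

  boundary⊆ : boundary ⊆ Y
  boundary⊆ = proj₁ ∘ ∈-subset⁻ on-boundary?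

  boundary-adjacent : ∀ {x} → x ∈ boundary → Adjacent x
  boundary-adjacent = proj₂ ∘ ∈-subset⁻ on-boundary?

  reach-boundary⇒reach : t ∉ Y → ∀ {v} → Reach G boundary t v → Reach G Y t v
  reach-boundary⇒reach t∉Y (_ , p) = go p (reach-refl G t∉Y)
    where
    go : ∀ {u v vs} → WalkIn G boundary u v vs → Reach G Y t u → Reach G Y t v
    go (single _) t⇝u = t⇝u
    go {u} (cons {w = w} _ e p) t⇝u with w ∈? Y
    ... | yes w∈Y = ⊥-elim (walk-head∉ G p (∈-subset⁺ on-boundary? (w∈Y , u , t⇝u , e)))
    ... | no w∉Y  = go p (reach-snoc G t⇝u e w∉Y)

  boundary-beyond : ∀ {I} → (∀ {v} → Reach G boundary t v → Reach G I t v) →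
    ∀ {x} → x ∈ boundary → x ∈ I ⊎ Reach G I t x
  boundary-beyond {I} dominates {x} x∈ with boundary-adjacent x∈ | x ∈? I
  ... | _               | yes x∈I = inj₁ x∈I
  ... | r , t⇝r , e     | no x∉I  = inj₂ (reach-snoc G (dominates (reach-antimono G boundary⊆ t⇝r)) e x∉I)

module Push {n : ℕ} (G : Graph n) (T S I X : Subset n) (t w : Fin n)
  (noTwo : ∀ ti tj → ti ∈ T → tj ∈ T → ti ≢ tj → ¬ TwoDisjointPaths G S ti tj)
  (I∩T : Empty (I ∩ T)) (sepI : IsSep G ⁅ t ⁆ (T - t) I) (w∈I : w ∈ I) (w∉S : w ∉ S)
  (X-beyond : ∀ {x} → x ∈ X → x ∈ I ⊎ Reach G I t x) where

  S* : Subset n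
  S* = (S ─ X) ∪ (I - w)

  B : Fin n → Set
  B = Reach G I t

  B? : Decidable B
  B? = reach? G I t

  ¬Bw : ¬ B w
  ¬Bw t⇝w = reach-last∉ G t⇝w w∈I

  w∉T : w ∉ T
  w∉T w∈T = I∩T (w , x∈p∩q⁺ (w∈I , w∈T))

  B-terminal : ∀ {y} → B y → y ∈ T → y ≡ t
  B-terminal {y} t⇝y y∈T = decidable-stable (y ≟ t) λ y≢t →
    sepI t y (x∈⁅x⁆ t) (x∈p∧x≢y⇒x∈p-y y∈T y≢t) t⇝y

  crossing : ∀ {x y} → B x → ¬ B y → E G x y ≡ true → y ∉ S* → y ≡ w
  crossing Bx ¬By e y∉S* with _ ∈? I
  ... | no y∉I = contradiction (reach-snoc G Bx e y∉I) ¬By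
  ... | yes y∈I = decidable-stable (_ ≟ w) λ y≢w → y∉S* (q⊆p∪q (S ─ X) (I - w) (x∈p∧x≢y⇒x∈p-y y∈I y≢w))

  walk-through-w : ∀ {a b vs} → WalkIn G S* a b vs → (B a × ¬ B b) ⊎ (¬ B a × B b) → w ∈ₗ vs
  walk-through-w (single _) (inj₁ (Ba , ¬Ba)) = contradiction Ba ¬Ba
  walk-through-w (single _) (inj₂ (¬Ba , Ba)) = contradiction Ba ¬Ba
  walk-through-w (cons {w = a′} _ e p) (inj₁ (Ba , ¬Bb)) with B? a′
  ... | yes Ba′ = there (walk-through-w p (inj₁ (Ba′ , ¬Bb)))
  ... | no ¬Ba′ = there (subst (_∈ₗ _) (crossing Ba ¬Ba′ e (walk-head∉ G p)) (walk-head∈ G p))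
  walk-through-w (cons {w = a′} a∉S* e p) (inj₂ (¬Ba , Bb)) with B? a′
  ... | yes Ba′ = here (≡.sym (crossing Ba′ ¬Ba (edge-sym G e) a∉S*))
  ... | no ¬Ba′ = there (walk-through-w p (inj₂ (¬Ba′ , Bb)))

  path-avoids-B : ∀ {a b vs} → PathIn G S* a b vs → ¬ B a → ¬ B b → ∀ {z} → z ∈ₗ vs → ¬ B z
  path-avoids-B (p , uniq) ¬Ba ¬Bb z∈ Bz with walk-split G p z∈
  ... | pre , suf , refl , p₁ , p₂ = Unique-++⇒Disjoint pre uniq (w∈pre , w∈suf)
    where
    w≢z : w ≢ _
    w≢z refl = ¬Bw Bz
    w∈pre : w ∈ₗ pre
    w∈pre with ∈-++⁻ pre (walk-through-w p₁ (inj₂ (¬Ba , Bz)))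
    ... | inj₁ w∈pre     = w∈pre
    ... | inj₂ (here eq) = contradiction eq w≢z
    w∈suf : w ∈ₗ _ ∷ suf
    w∈suf = walk-through-w p₂ (inj₁ (Bz , ¬Bb))

  path-in-G-S : ∀ {a b vs} → PathIn G S* a b vs → ¬ B a → ¬ B b → WalkIn G S a b vs
  path-in-G-S path@(p , _) ¬Ba ¬Bb = walk-antimono G p z∉S
    where
    z∉S : ∀ {z} → z ∈ₗ _ → z ∉ S
    z∉S {z} z∈ z∈S with z ∈? X
    ... | no z∉X = walk-∉ G p z∈ (p⊆p∪q (I - w) (x∈p∧x∉q⇒x∈p─q z∈S z∉X))
    ... | yes z∈X with X-beyond z∈X
    ...   | inj₂ Bz  = path-avoids-B path ¬Ba ¬Bb z∈ Bz
    ...   | inj₁ z∈I with z ≟ w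
    ...     | yes refl = w∉S z∈S
    ...     | no z≢w   = walk-∉ G p z∈ (q⊆p∪q (S ─ X) (I - w) (x∈p∧x≢y⇒x∈p-y z∈I z≢w))

  separated-by-w : ∀ {a b} → a ∈ T → b ∈ T → (B a × ¬ B b) ⊎ (¬ B a × B b) → ¬ TwoDisjointPaths G S* a b
  separated-by-w a∈T b∈T side (_ , _ , (p , _) , (q , _) , P∩Q)
    with P∩Q w (walk-through-w p side) (walk-through-w q side)
  ... | inj₁ refl = w∉T a∈T
  ... | inj₂ refl = w∉T b∈T

  two-paths-in-G-S : ∀ {a b} → ¬ B a → ¬ B b → TwoDisjointPaths G S* a b → TwoDisjointPaths G S a b
  two-paths-in-G-S ¬Ba ¬Bb (P , Q , pathP , pathQ , P∩Q) =
    P , Q , (path-in-G-S pathP ¬Ba ¬Bb , proj₂ pathP) , (path-in-G-S pathQ ¬Ba ¬Bb , proj₂ pathQ) , P∩Q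

  no-two-paths : ∀ ti tj → ti ∈ T → tj ∈ T → ti ≢ tj → ¬ TwoDisjointPaths G S* ti tj
  no-two-paths a b a∈T b∈T a≢b with B? a | B? b
  ... | yes Ba | yes Bb = λ _ → a≢b (≡.trans (B-terminal Ba a∈T) (≡.sym (B-terminal Bb b∈T)))
  ... | yes Ba | no ¬Bb = separated-by-w a∈T b∈T (inj₁ (Ba , ¬Bb))
  ... | no ¬Ba | yes Bb = separated-by-w a∈T b∈T (inj₂ (¬Ba , Bb))
  ... | no ¬Ba | no ¬Bb = noTwo a b a∈T b∈T a≢b ∘ two-paths-in-G-S ¬Ba ¬Bb

Conclusion : {n : ℕ} → Graph n → Subset n → ℕ → Subset n → Set
Conclusion G T k S =
  ∃[ t ] ∃[ S* ] (t ∈ T × IsSolution G T k S* × ∣ S* ∣ ≤ ∣ S ∣ ×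
    ((∃[ S*t ] (IsImportant G T ⁅ t ⁆ (T - t) S*t × ∣ S*t ∣ ≤ k × S*t ⊆ S*))
     ⊎ (∃[ St ] ∃[ v ] (IsImportant G T ⁅ t ⁆ (T - t) St × ∣ St ∣ ≤ suc k ×
          v ∈ St × (St - v) ⊆ S*))))

some-terminal : ∀ {n} (G : Graph n) (T : Subset n) (k : ℕ) → NonTrivial G T k → ∃[ t ] t ∈ T
some-terminal {n} G T k nonTrivial = decidable-stable (any? (_∈? T)) λ no-terminal →
  nonTrivial (subst (_≤ k) (≡.sym (∣⊥∣≡0 n)) z≤n , Empty[⊥∩p] ,
              λ ti _ ti∈T → contradiction (ti , ti∈T) no-terminal)

module Replacement {n : ℕ} (G : Graph n) (T : Subset n) (k : ℕ) (S : Subset n)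
  (∣S∣≤k : ∣ S ∣ ≤ k) (S∩T : Empty (S ∩ T))
  (noTwo : ∀ ti tj → ti ∈ T → tj ∈ T → ti ≢ tj → ¬ TwoDisjointPaths G S ti tj)
  (t : Fin n) (Z : Subset n) (t∈T : t ∈ T) (∣Z∣≤1 : ∣ Z ∣ ≤ 1) (Z∩T : Empty (Z ∩ T))
  (isolated : Isolated G T t (S ∪ Z)) where

  Y : Subset n
  Y = S ∪ Z

  ∣Y∣≤1+∣S∣ : ∣ Y ∣ ≤ suc ∣ S ∣
  ∣Y∣≤1+∣S∣ = ≤-trans (∣p∪q∣≤∣p∣+∣q∣ S Z) (≤-trans (+-monoʳ-≤ ∣ S ∣ ∣Z∣≤1) (≤-reflexive (+-comm ∣ S ∣ 1)))

  Y∩T : Empty (Y ∩ T)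
  Y∩T = Empty-∪-∩ S∩T Z∩T

  open Boundary G Y t
  open ImportantSeparator G T (T - t) t

  boundary∩T : Empty (boundary ∩ T)
  boundary∩T = Empty-∩-⊆ boundary⊆ Y∩T

  boundary-separates : Sep boundary
  boundary-separates x y x∈⁅t⁆ y∈T-t t⇝y with x∈⁅y⁆⇒x≡y t x∈⁅t⁆ | x∈p-y⁻ T y∈T-t
  ... | refl | y∈T , y≢t = isolated y y∈T y≢t (reach-boundary⇒reach t∉Y t⇝y)
    where
    t∉Y : t ∉ Y
    t∉Y t∈Y = Y∩T (t , x∈p∩q⁺ (t∈Y , t∈T))

  module _ (I : Subset n) (important : IsImportant G T ⁅ t ⁆ (T - t) I)
    (∣I∣≤∣boundary∣ : ∣ I ∣ ≤ ∣ boundary ∣) (dominates : ∀ {v} → Reach G boundary t v → Reach G I t v) where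

    keep-S : I ⊆ S → Conclusion G T k S
    keep-S I⊆S = t , S , t∈T , (∣S∣≤k , S∩T , noTwo) , ≤-refl ,
      inj₁ (I , important , ≤-trans (p⊆q⇒∣p∣≤∣q∣ I⊆S) ∣S∣≤k , I⊆S)

    push : ∀ {w} → w ∈ I → w ∉ S → Conclusion G T k S
    push {w} w∈I w∉S = t , S* , t∈T , (≤-trans ∣S*∣≤∣S∣ ∣S∣≤k , S*∩T , no-two-paths) , ∣S*∣≤∣S∣ ,
      inj₂ (I , w , important , ≤-trans ∣I∣≤1+∣S∣ (s≤s ∣S∣≤k) , w∈I , q⊆p∪q (S ─ boundary) (I - w))
      where
      open Push G T S I boundary t w noTwo (proj₁ important) (proj₁ (proj₂ important)) w∈I w∉S
                (boundary-beyond dominates)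
      ∣I∣≤1+∣S∣ : ∣ I ∣ ≤ suc ∣ S ∣
      ∣I∣≤1+∣S∣ = ≤-trans ∣I∣≤∣boundary∣ (≤-trans (p⊆q⇒∣p∣≤∣q∣ boundary⊆) ∣Y∣≤1+∣S∣)
      ∣S*∣≤∣S∣ : ∣ S* ∣ ≤ ∣ S ∣
      ∣S*∣≤∣S∣ = ≤-pred (≤-trans (∣p─q∪r-x∣<∣p∪q∣ {p = S} w∈I ∣I∣≤∣boundary∣)
        (≤-trans (p⊆q⇒∣p∣≤∣q∣ (p⊆r∧q⊆r⇒p∪q⊆r (p⊆p∪q Z) boundary⊆)) ∣Y∣≤1+∣S∣))
      S*∩T : Empty (S* ∩ T)
      S*∩T = Empty-∪-∩ (Empty-∩-⊆ (p─q⊆p S boundary) S∩T) (Empty-∩-⊆ (p─q⊆p I ⁅ w ⁆) (proj₁ important))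

  replacement : Conclusion G T k S
  replacement with important-dominating boundary boundary∩T boundary-separates
  ... | I , important , ∣I∣≤ , dominates with any? (λ x → (x ∈? I) ×-dec ¬? (x ∈? S))
  ...   | yes (w , w∈I , w∉S) = push I important ∣I∣≤ dominates w∈I w∉S
  ...   | no none = keep-S I important ∣I∣≤ dominates
                    λ {x} x∈I → decidable-stable (x ∈? S) λ x∉S → none (x , x∈I , x∉S)

lemma3p2 : ∀ {n} (G : Graph n) (T : Subset n) (k : ℕ) → 1 ≤ k →
    NonTrivial G T k → (S : Subset n) → IsSolution G T k S →
    ∃[ t ] ∃[ S* ] (t ∈ T × IsSolution G T k S* × ∣ S* ∣ ≤ ∣ S ∣ ×
      ((∃[ S*t ] (IsImportant G T ⁅ t ⁆ (T - t) S*t × ∣ S*t ∣ ≤ k × S*t ⊆ S*))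
       ⊎ (∃[ St ] ∃[ v ] (IsImportant G T ⁅ t ⁆ (T - t) St × ∣ St ∣ ≤ suc k ×
            v ∈ St × (St - v) ⊆ S*))))
lemma3p2 G T k _ nonTrivial S (∣S∣≤k , S∩T , noTwo)
  with Isolation.isolated-terminal G T S noTwo (proj₂ (some-terminal G T k nonTrivial))
... | t , Z , t∈T , ∣Z∣≤1 , Z∩T , isolated =
  Replacement.replacement G T k S ∣S∣≤k S∩T noTwo t Z t∈T ∣Z∣≤1 Z∩T isolated
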